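{- Let $a,b\ge 2$ be integers and let $R_{a,b}=\{C_{i,j}:1\le i\le a,\ 1\le j\le b\}$ be the $a\times b$ rectangular polyomino (of size $n=ab$). Then on the $ab\times ab$ board, $$\mathrm{cp}_{\mathrm{fixed}}(R_{a,b})=\left\lceil \frac{ab-a+1}{2a-1}\right\rceil\left\lceil \frac{ab-b+1}{2b-1}\right\rceil.$$
   Context: A cell $C_{i,j}$ ($i,j$ integers) is the closed unit square in column $i$ and row $j$ of the integer grid. A polyomino is a finite set of cells; its size is its number of cells. For a polyomino $\mathcal P$ of size $n$, the board is $\mathbb B=\{C_{i,j}:1\le i,j\le n\}$. A shift of $\mathcal P$ by an integer pair $(c,d)$ is $\{C_{x+c,y+d}:C_{x,y}\in\mathcal P\}$; two polyominoes are fixed equivalent if one is a shift of the other. A set of polyominoes is a valid arrangement if all lie in $\mathbb B$ and they are pairwise disjoint. A fixed packing of $\mathcal P$ is a valid arrangement of polyominoes fixed equivalent to $\mathcal P$ such that adding any further polyomino fixed equivalent to $\mathcal P$ yields an invalid arrangement. The clumsy fixed packing number $\mathrm{cp}_{\mathrm{fixed}}(\mathcal P)$ is the minimum number of polyominoes in a fixed packing of $\mathcal P$ on the $n\times n$ board, $n=|\mathcal P|$. -}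

module Defs where

open import Data.Nat as ℕ using (ℕ; zero; suc; _/_)
open import Data.Integer as ℤ using (ℤ; +_)
open import Data.Product using (_×_; _,_; ∃)
open import Data.List using (List; []; _∷_; map; length; lookup; concatMap; upTo)
open import Data.List.Membership.Propositional using (_∈_)
open import Data.List.Relation.Unary.All using (All)
open import Data.Fin using (Fin)
open import Relation.Binary.PropositionalEquality using (_≡_; _≢_)
open import Relation.Nullary using (¬_)
open import Data.Empty using (⊥)

Cell : Set
Cell = ℤ × ℤ

-- A polyomino is a finite set of cells, represented as a list of cells
-- (without repetitions for the polyominoes we construct).
Polyomino : Set
Polyomino = List Cell

shift : ℤ × ℤ → Polyomino → Polyomino
shift (c , d) P = map (λ { (x , y) → (x ℤ.+ c , y ℤ.+ d) }) P

InBoard : ℕ → Cell → Set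
InBoard n (i , j) = (+ 1 ℤ.≤ i × i ℤ.≤ + n) × (+ 1 ℤ.≤ j × j ℤ.≤ + n)

Disjoint : Polyomino → Polyomino → Set
Disjoint A B = ∀ x → x ∈ A → x ∈ B → ⊥

-- An arrangement of copies of P (fixed equivalent = shifts) is given by the
-- list of shift vectors; the i-th polyomino is shift (lookup S i) P.
-- Valid: every copy lies in the board and distinct copies are disjoint.
ValidArrangement : ℕ → Polyomino → List (ℤ × ℤ) → Set
ValidArrangement n P S =
  All (λ s → All (InBoard n) (shift s P)) S ×
  (∀ (k l : Fin (length S)) → k ≢ l →
     Disjoint (shift (lookup S k) P) (shift (lookup S l) P))

IsFixedPacking : ℕ → Polyomino → List (ℤ × ℤ) → Set
IsFixedPacking n P S =
  ValidArrangement n P S × (∀ (s : ℤ × ℤ) → ¬ ValidArrangement n P (s ∷ S))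

CpFixedIs : Polyomino → ℕ → Set
CpFixedIs P v =
  (∃ λ S → IsFixedPacking (length P) P S × length S ≡ v) ×
  (∀ S → IsFixedPacking (length P) P S → v ℕ.≤ length S)

rect : ℕ → ℕ → Polyomino
rect a b = concatMap (λ i → map (λ j → (+ suc i , + suc j)) (upTo b)) (upTo a)

-- ceiling division ⌈ x / y ⌉ (y > 0; value 0 for y = 0, unused)
ceilDiv : ℕ → ℕ → ℕ
ceilDiv x zero = 0
ceilDiv x (suc k) = (x ℕ.+ k) / suc k

-- A copy of R_{a,b} on the n × n board is its shift by naturals (c , d) with c + a ≤ n and
-- d + b ≤ n, and two copies meet iff |c − c'| < a and |d − d'| < b.  So the problem is the
-- product of two problems on a segment [0 , N], N = n − a, with windows of width w = a.
-- Put D = 2w − 1 and k = ⌈(N + 1)/D⌉.  The k probes iD are pairwise D apart, so no window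
-- meets two of them; a maximal packing must meet the copy at every probe pair, so it has at
-- least k_a k_b copies.  Conversely the k slots min(iD + w − 1, N) are pairwise at least w
-- apart and every point of [0 , N] is within w − 1 of one, so the copies at the slot pairs
-- form a maximal packing with exactly k_a k_b copies.
module Submission where

open import Defs
open import Data.Nat
  using (ℕ; zero; suc; _+_; _*_; _∸_; _≤_; _<_; _⊓_; z≤n; s≤s; s≤s⁻¹; z<s; _<?_; NonZero; >-nonZero⁻¹)
open import Data.Nat.Properties
open import Data.Nat.DivMod using (_/_; _%_; m≡m%n+[m/n]*n; m%n<n; m/n*n≤m; m<n*o⇒m/o<n)
open import Data.Nat.Tactic.RingSolver using (solve-∀)
open import Data.Fin as Fin using (Fin; toℕ; fromℕ<; remQuot; combine)
import Data.Fin.Properties as Fin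
open import Data.Integer as ℤ using (ℤ; +_; -[1+_]; +≤+)
import Data.Integer.Properties as ℤ
open import Data.List using (List; []; _∷_; map; length; lookup; concatMap; upTo; tabulate)
open import Data.List.Properties using (length-map; length-upTo; length-++; length-tabulate; lookup-tabulate)
open import Data.List.Membership.Propositional using (_∈_; find)
open import Data.List.Membership.Propositional.Properties
  using (∈-map⁺; ∈-map⁻; ∈-concatMap⁺; ∈-concatMap⁻; ∈-upTo⁺; ∈-upTo⁻; ∈-lookup)
import Data.List.Relation.Unary.Any as Any
open import Data.List.Relation.Unary.All as All using (All)
import Data.List.Relation.Unary.All.Properties as All
open import Data.Product using (∃; ∃₂; _×_; _,_; proj₁; proj₂; swap; uncurry)
open import Data.Empty using (⊥; ⊥-elim)
open import Data.Sum using (inj₁; inj₂)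
open import Function using (_∘_)
open import Relation.Binary.Definitions using (tri<; tri≈; tri>)
open import Relation.Binary.PropositionalEquality
open import Relation.Nullary using (¬_; Dec; yes; no)
open import Relation.Nullary.Decidable using (_×-dec_)

Near : ℕ → ℕ → ℕ → Set
Near w x y = x < y + w × y < x + w

near? : ∀ w x y → Dec (Near w x y)
near? w x y = (x <? y + w) ×-dec (y <? x + w)

near-sym : ∀ {w x y} → Near w x y → Near w y x
near-sym = swap

symmetric-¬<⇒≡ : ∀ {k} (P : Fin k → Fin k → Set) → (∀ {i j} → P i j → P j i) →
  (∀ {i j} → i Fin.< j → ¬ P i j) → ∀ {i j} → P i j → i ≡ j
symmetric-¬<⇒≡ P P-sym P-< {i} {j} p with Fin.<-cmp i j
... | tri< i<j _ _ = ⊥-elim (P-< i<j p)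
... | tri≈ _ i≡j _ = i≡j
... | tri> _ _ j<i = ⊥-elim (P-< j<i (P-sym p))

ceilDiv-bounds : ∀ N e → let k = ceilDiv (N + 1) (suc e) in
  (∀ m → m < k → m * suc e ≤ N) × N < k * suc e
ceilDiv-bounds N e = below , above
  where
  k D : ℕ
  k = ceilDiv (N + 1) (suc e)
  D = suc e
  k*D≤N+D : k * D ≤ N + D
  k*D≤N+D = ≤-trans (m/n*n≤m (N + 1 + e) D) (≤-reflexive (+-assoc N 1 e))
  below : ∀ m → m < k → m * D ≤ N
  below m m<k = +-cancelʳ-≤ D (m * D) N (begin
    m * D + D  ≡⟨ +-comm (m * D) D ⟩
    suc m * D  ≤⟨ *-monoˡ-≤ D m<k ⟩
    k * D      ≤⟨ k*D≤N+D ⟩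
    N + D      ∎)
    where open ≤-Reasoning
  above : N < k * D
  above = +-cancelʳ-≤ e (suc N) (k * D) (begin
    suc N + e              ≡⟨ cong (_+ e) (+-comm 1 N) ⟩
    N + 1 + e              ≡⟨ m≡m%n+[m/n]*n (N + 1 + e) D ⟩
    (N + 1 + e) % D + k * D ≤⟨ +-monoˡ-≤ (k * D) (s≤s⁻¹ (m%n<n (N + 1 + e) D)) ⟩
    e + k * D              ≡⟨ +-comm e (k * D) ⟩
    k * D + e              ∎)
    where open ≤-Reasoning

module Segment (w' N : ℕ) where

  w D count : ℕ
  w = suc w'
  D = w + w'
  count = ceilDiv (N + 1) (2 * w ∸ 1)

  private
    -- 2 * w ∸ 1 normalises to w' + (w + 0)
    count-bounds : (∀ m → m < count → m * D ≤ N) × N < count * D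
    count-bounds rewrite trans (cong (_+_ w') (+-identityʳ w)) (+-suc w' w') = ceilDiv-bounds N (w' + w')

    below : ∀ m → m < count → m * D ≤ N
    below = proj₁ count-bounds

    *D+w'+w≡suc*D : ∀ x v → x * (suc v + v) + v + suc v ≡ suc x * (suc v + v)
    *D+w'+w≡suc*D = solve-∀

    multiple-gap : ∀ {i j} → i < j → i * D + D ≤ j * D
    multiple-gap {i} {j} i<j = subst (_≤ j * D) (+-comm D (i * D)) (*-monoˡ-≤ D i<j)

  ¬near-both : ∀ {x y c} → x + D ≤ y → Near w x c → Near w y c → ⊥
  ¬near-both {x} {y} {c} x+D≤y (_ , c<x+w) (y<c+w , _) = <-irrefl refl (begin-strict
    y            <⟨ y<c+w ⟩
    c + w        ≤⟨ +-monoˡ-≤ w (s≤s⁻¹ (≤-trans c<x+w (≤-reflexive (+-suc x w')))) ⟩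
    x + w' + w   ≡⟨ trans (+-assoc x w' w) (cong (_+_ x) (+-comm w' w)) ⟩
    x + D        ≤⟨ x+D≤y ⟩
    y            ∎)
    where open ≤-Reasoning

  probe : Fin count → ℕ
  probe i = toℕ i * D

  probe-≤ : ∀ i → probe i ≤ N
  probe-≤ i = below (toℕ i) (Fin.toℕ<n i)

  probe-isolated : ∀ {i j c} → Near w (probe i) c → Near w (probe j) c → i ≡ j
  probe-isolated {c = c} p q = symmetric-¬<⇒≡ (λ i j → Near w (probe i) c × Near w (probe j) c) swap
    (λ i<j (p , q) → ¬near-both (multiple-gap i<j) p q) (p , q)

  -- The window of slot i, iD + w' ± w', is exactly [iD , (i + 1)D): hence D = 2w − 1.
  slot : Fin count → ℕ
  slot i = (toℕ i * D + w') ⊓ N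

  slot-≤ : ∀ i → slot i ≤ N
  slot-≤ i = m⊓n≤n _ N

  private
    slot-gap : ∀ {i j} → i Fin.< j → slot i + w ≤ slot j
    slot-gap {i} {j} i<j = begin
      slot i + w               ≤⟨ +-monoˡ-≤ w (m⊓n≤m _ N) ⟩
      toℕ i * D + w' + w      ≡⟨ *D+w'+w≡suc*D (toℕ i) w' ⟩
      suc (toℕ i) * D         ≤⟨ ⊓-glb (≤-trans (*-monoˡ-≤ D i<j) (m≤m+n _ w'))
                                       (below _ (≤-<-trans i<j (Fin.toℕ<n j))) ⟩
      slot j                   ∎
      where open ≤-Reasoning

  slot-apart : ∀ {i j} → Near w (slot i) (slot j) → i ≡ j
  slot-apart = symmetric-¬<⇒≡ (λ i j → Near w (slot i) (slot j)) near-sym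
    (λ i<j (_ , pj<pi+w) → <⇒≱ pj<pi+w (slot-gap i<j))

  slots-cover : ∀ {c} → c ≤ N → ∃ λ i → Near w c (slot i)
  slots-cover {c} c≤N = fromℕ< q<count , c<slot+w , slot<c+w
    where
    q : ℕ
    q = c / D
    q<count : q < count
    q<count = m<n*o⇒m/o<n (≤-<-trans c≤N (proj₂ count-bounds))
    open ≤-Reasoning
    c<slot+w : c < slot (fromℕ< q<count) + w
    c<slot+w rewrite Fin.toℕ-fromℕ< q<count | +-distribʳ-⊓ w (q * D + w') N = ⊓-glb
      (begin-strict
        c                    ≡⟨ m≡m%n+[m/n]*n c D ⟩
        c % D + q * D        <⟨ +-monoˡ-< (q * D) (m%n<n c D) ⟩
        D + q * D            ≡⟨ *D+w'+w≡suc*D q w' ⟨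
        q * D + w' + w       ∎)
      (≤-<-trans c≤N (m<m+n N (s≤s z≤n)))
    slot<c+w : slot (fromℕ< q<count) < c + w
    slot<c+w rewrite Fin.toℕ-fromℕ< q<count = begin-strict
      (q * D + w') ⊓ N   ≤⟨ m⊓n≤m _ N ⟩
      q * D + w'         ≤⟨ +-monoˡ-≤ w' (m/n*n≤m c D) ⟩
      c + w'             <⟨ +-monoʳ-< c (n<1+n w') ⟩
      c + w              ∎

common⇒near : ∀ {w i i' c c'} → i < w → i' < w → i + c ≡ i' + c' → Near w c c'
common⇒near {w} {i} {i'} {c} {c'} i<w i'<w e = before i'<w e , before i<w (sym e)
  where
  before : ∀ {i i' c c'} → i' < w → i + c ≡ i' + c' → c < c' + w
  before {i} {i'} {c} {c'} i'<w e = begin-strict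
    c         ≤⟨ m≤n+m c i ⟩
    i + c     ≡⟨ e ⟩
    i' + c'   <⟨ +-monoˡ-< c' i'<w ⟩
    w + c'    ≡⟨ +-comm w c' ⟩
    c' + w    ∎
    where open ≤-Reasoning

near⇒common : ∀ {w c c'} .{{_ : NonZero w}} → Near w c c' →
  ∃₂ λ i i' → i < w × i' < w × i + c ≡ i' + c'
near⇒common {w} {c} {c'} (c<c'+w , c'<c+w) with ≤-total c c'
... | inj₁ c≤c' = c' ∸ c , 0 , m<n+o⇒m∸n<o c' c c'<c+w , >-nonZero⁻¹ w , m∸n+n≡m c≤c'
... | inj₂ c'≤c = 0 , c ∸ c' , >-nonZero⁻¹ w , m<n+o⇒m∸n<o c c' c<c'+w , sym (m∸n+n≡m c'≤c)

-- place (c , d) moves R_{a,b} onto the columns c + 1 … c + a and the rows d + 1 … d + b.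
place : ℕ × ℕ → ℤ × ℤ
place (c , d) = + c , + d

Fits : ℕ → ℕ → ℕ → ℕ × ℕ → Set
Fits n a b (c , d) = c + a ≤ n × d + b ≤ n

Overlap : ℕ → ℕ → ℕ × ℕ → ℕ × ℕ → Set
Overlap a b (c , d) (c' , d') = Near a c c' × Near b d d'

overlap? : ∀ a b u v → Dec (Overlap a b u v)
overlap? a b (c , d) (c' , d') = near? a c c' ×-dec near? b d d'

module _ {a b : ℕ} where

  private
    column : ℕ → List Cell
    column i = map (λ j → + suc i , + suc j) (upTo b)

  length-rect : length (rect a b) ≡ a * b
  length-rect = trans (length-concatMap (upTo a)) (cong (_* b) (length-upTo a))
    where
    length-concatMap : ∀ is → length (concatMap column is) ≡ length is * b
    length-concatMap []       = refl
    length-concatMap (i ∷ is) = trans (length-++ (column i))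
      (cong₂ _+_ (trans (length-map _ (upTo b)) (length-upTo b)) (length-concatMap is))

  ∈-shift-rect⁺ : ∀ {i j c d} → i < a → j < b →
    (+ suc i ℤ.+ c , + suc j ℤ.+ d) ∈ shift (c , d) (rect a b)
  ∈-shift-rect⁺ {i} i<a j<b = ∈-map⁺ _ (∈-concatMap⁺ column
    (Any.map (λ { refl → ∈-map⁺ _ (∈-upTo⁺ j<b) }) (∈-upTo⁺ {i = i} i<a)))

  ∈-shift-rect⁻ : ∀ {x c d} → x ∈ shift (c , d) (rect a b) →
    ∃₂ λ i j → i < a × j < b × x ≡ (+ suc i ℤ.+ c , + suc j ℤ.+ d)
  ∈-shift-rect⁻ x∈ with ∈-map⁻ _ x∈
  ... | y , y∈ , refl with find (∈-concatMap⁻ column {xs = upTo a} y∈)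
  ... | i , i∈ , y∈col with ∈-map⁻ _ y∈col
  ... | j , j∈ , refl = i , j , ∈-upTo⁻ i∈ , ∈-upTo⁻ j∈ , refl

  fits⇒inBoard : ∀ {n u} → Fits n a b u → All (InBoard n) (shift (place u) (rect a b))
  fits⇒inBoard {n} {c , d} (c+a≤n , d+b≤n) = All.tabulate λ x∈ → cell-inBoard (∈-shift-rect⁻ x∈)
    where
    coordinate : ∀ {i c w} → i < w → c + w ≤ n → + 1 ℤ.≤ + (suc i + c) × + (suc i + c) ℤ.≤ + n
    coordinate {i} {c} {w} i<w c+w≤n =
      +≤+ (s≤s z≤n) , +≤+ (≤-trans (+-monoˡ-≤ c i<w) (subst (_≤ n) (+-comm c w) c+w≤n))
    cell-inBoard : ∀ {x} → (∃₂ λ i j → i < a × j < b × x ≡ (+ (suc i + c) , + (suc j + d))) → InBoard n x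
    cell-inBoard (i , j , i<a , j<b , refl) = coordinate i<a c+a≤n , coordinate j<b d+b≤n

  shared-cell⇒overlap : ∀ {x u v} → x ∈ shift (place u) (rect a b) → x ∈ shift (place v) (rect a b) →
    Overlap a b u v
  shared-cell⇒overlap x∈u x∈v with ∈-shift-rect⁻ x∈u | ∈-shift-rect⁻ x∈v
  ... | i , j , i<a , j<b , refl | i' , j' , i'<a , j'<b , e =
    common⇒near i<a i'<a (suc-injective (ℤ.+-injective (cong proj₁ e))) ,
    common⇒near j<b j'<b (suc-injective (ℤ.+-injective (cong proj₂ e)))

  overlap⇒shared-cell : ∀ {u v} .{{_ : NonZero a}} .{{_ : NonZero b}} → Overlap a b u v →
    ∃ λ x → x ∈ shift (place u) (rect a b) × x ∈ shift (place v) (rect a b)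
  overlap⇒shared-cell {c , d} {c' , d'} (c~c' , d~d') with near⇒common c~c' | near⇒common d~d'
  ... | i , i' , i<a , i'<a , eᵢ | j , j' , j<b , j'<b , eⱼ =
    _ , ∈-shift-rect⁺ i<a j<b ,
    subst (_∈ shift (+ c' , + d') (rect a b)) (cong₂ (λ x y → + suc x , + suc y) (sym eᵢ) (sym eⱼ))
      (∈-shift-rect⁺ i'<a j'<b)

private
  1≤1+c⇒nonneg : ∀ {c} → + 1 ℤ.≤ + 1 ℤ.+ c → ∃ λ c' → c ≡ + c'
  1≤1+c⇒nonneg {+ c'}           _        = c' , refl
  1≤1+c⇒nonneg { -[1+ zero ] }  (+≤+ ())
  1≤1+c⇒nonneg { -[1+ suc _ ] } ()

inBoard⇒fits : ∀ {a' b' n s} → All (InBoard n) (shift s (rect (suc a') (suc b'))) →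
  ∃ λ u → s ≡ place u × Fits n (suc a') (suc b') u
inBoard⇒fits {a'} {b'} {n} {c , d} cells = corners⇒fits (corner z<s z<s) (corner (n<1+n a') (n<1+n b'))
  where
  corner : ∀ {i j} → i < suc a' → j < suc b' → InBoard n (+ suc i ℤ.+ c , + suc j ℤ.+ d)
  corner i<a j<b = All.lookup cells (∈-shift-rect⁺ i<a j<b)

  corners⇒fits : ∀ {c d} → InBoard n (+ 1 ℤ.+ c , + 1 ℤ.+ d) →
    InBoard n (+ suc a' ℤ.+ c , + suc b' ℤ.+ d) → ∃ λ u → (c , d) ≡ place u × Fits n (suc a') (suc b') u
  corners⇒fits {c} {d} ((1≤1+c , _) , (1≤1+d , _)) far
    with 1≤1+c⇒nonneg {c} 1≤1+c | 1≤1+c⇒nonneg {d} 1≤1+d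
  ... | c' , refl | d' , refl with far
  ... | (_ , +≤+ a+c≤n) , (_ , +≤+ b+d≤n) =
    (c' , d') , refl , subst (_≤ n) (+-comm (suc a') c') a+c≤n , subst (_≤ n) (+-comm (suc b') d') b+d≤n

module RectanglePacking (a' b' n : ℕ) where

  private
    a b : ℕ
    a = suc a'
    b = suc b'

  OnBoard : List (ℤ × ℤ) → Set
  OnBoard = All (λ s → All (InBoard n) (shift s (rect a b)))

  position : ∀ {S} → OnBoard S → Fin (length S) → ℕ × ℕ
  position inBoard k = proj₁ (inBoard⇒fits {a'} {b'} (All.lookup inBoard (∈-lookup k)))

  lookup≡place-position : ∀ {S} (inBoard : OnBoard S) k →
    lookup S k ≡ place (position inBoard k)
  lookup≡place-position inBoard k = proj₁ (proj₂ (inBoard⇒fits {a'} {b'} (All.lookup inBoard (∈-lookup k))))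

  ∷-valid : ∀ {S u} (valid : ValidArrangement n (rect a b) S) → Fits n a b u →
    (∀ k → ¬ Overlap a b u (position (proj₁ valid) k)) → ValidArrangement n (rect a b) (place u ∷ S)
  ∷-valid {S} {u} (inBoard , disjoint) u-fits u-apart =
    fits⇒inBoard {a} {b} u-fits All.∷ inBoard , pairwise
    where
    new-disjoint : ∀ k → Disjoint (shift (place u) (rect a b)) (shift (lookup S k) (rect a b))
    new-disjoint k x x∈u x∈k = u-apart k (shared-cell⇒overlap x∈u
      (subst (λ s → x ∈ shift s (rect a b)) (lookup≡place-position inBoard k) x∈k))

    pairwise : ∀ k l → k ≢ l →
      Disjoint (shift (lookup (place u ∷ S) k) (rect a b)) (shift (lookup (place u ∷ S) l) (rect a b))
    pairwise Fin.zero    Fin.zero    k≢l = ⊥-elim (k≢l refl)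
    pairwise Fin.zero    (Fin.suc l) _   = new-disjoint l
    pairwise (Fin.suc k) Fin.zero    _   = λ x x∈k x∈u → new-disjoint k x x∈u x∈k
    pairwise (Fin.suc k) (Fin.suc l) k≢l = disjoint k l (k≢l ∘ cong Fin.suc)

  packing-overlaps : ∀ {S u} (packing : IsFixedPacking n (rect a b) S) → Fits n a b u →
    ∃ λ k → Overlap a b u (position (proj₁ (proj₁ packing)) k)
  packing-overlaps {u = u} (valid , maximal) u-fits
    with Fin.any? (λ k → overlap? a b u (position (proj₁ valid) k))
  ... | yes found = found
  ... | no ¬overlap = ⊥-elim (maximal (place u) (∷-valid valid u-fits (λ k o → ¬overlap (k , o))))

  fixedPacking-length-≥ : ∀ {S m} → IsFixedPacking n (rect a b) S → (t : Fin m → ℕ × ℕ) →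
    (∀ x → Fits n a b (t x)) → (∀ {x y v} → Overlap a b (t x) v → Overlap a b (t y) v → x ≡ y) →
    m ≤ length S
  fixedPacking-length-≥ {S} packing t t-fits t-isolated = Fin.injective⇒≤ λ {x} {y} hx≡hy →
    t-isolated (proj₂ (hit x)) (subst (Overlap a b (t y) ∘ position inBoard) (sym hx≡hy) (proj₂ (hit y)))
    where
    inBoard : OnBoard S
    inBoard = proj₁ (proj₁ packing)
    hit : ∀ x → ∃ λ k → Overlap a b (t x) (position inBoard k)
    hit x = packing-overlaps packing (t-fits x)

  tabulate-fixedPacking : ∀ {m} (g : Fin m → ℕ × ℕ) → (∀ x → Fits n a b (g x)) →
    (∀ {x y} → Overlap a b (g x) (g y) → x ≡ y) → (∀ {u} → Fits n a b u → ∃ λ x → Overlap a b u (g x)) →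
    IsFixedPacking n (rect a b) (tabulate (place ∘ g))
  tabulate-fixedPacking {m} g g-fits g-apart g-covers =
    (All.tabulate⁺ (λ x → fits⇒inBoard {a} {b} (g-fits x)) , disjoint) , maximal
    where
    S : List (ℤ × ℤ)
    S = tabulate (place ∘ g)
    |S|≡m : length S ≡ m
    |S|≡m = length-tabulate (place ∘ g)

    uncast : ∀ k → Fin.cast (sym |S|≡m) (Fin.cast |S|≡m k) ≡ k
    uncast = Fin.cast-involutive (sym |S|≡m) |S|≡m

    lookup-S : ∀ k → lookup S k ≡ place (g (Fin.cast |S|≡m k))
    lookup-S k = trans (cong (lookup S) (sym (uncast k))) (lookup-tabulate (place ∘ g) (Fin.cast |S|≡m k))

    disjoint : ∀ k l → k ≢ l → Disjoint (shift (lookup S k) (rect a b)) (shift (lookup S l) (rect a b))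
    disjoint k l k≢l x x∈k x∈l = k≢l (cast-injective (g-apart (shared-cell⇒overlap
      (subst (λ s → x ∈ shift s (rect a b)) (lookup-S k) x∈k)
      (subst (λ s → x ∈ shift s (rect a b)) (lookup-S l) x∈l))))
      where
      cast-injective : Fin.cast |S|≡m k ≡ Fin.cast |S|≡m l → k ≡ l
      cast-injective e = trans (sym (uncast k)) (trans (cong (Fin.cast (sym |S|≡m)) e) (uncast l))

    maximal : ∀ s → ¬ ValidArrangement n (rect a b) (s ∷ S)
    maximal s (s∷S-inBoard , s∷S-disjoint) with inBoard⇒fits {a'} {b'} (All.head s∷S-inBoard)
    ... | u , refl , u-fits with g-covers u-fits
    ... | x , u~gx with overlap⇒shared-cell {a} {b} u~gx
    ... | y , y∈u , y∈gx = s∷S-disjoint Fin.zero (Fin.suc (Fin.cast (sym |S|≡m) x)) (λ ()) y y∈u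
      (subst (λ s → y ∈ shift s (rect a b)) (sym (lookup-tabulate (place ∘ g) x)) y∈gx)

module _ {kx ky : ℕ} where

  grid : (Fin kx → ℕ) → (Fin ky → ℕ) → Fin (kx * ky) → ℕ × ℕ
  grid f g z = f (proj₁ (remQuot {kx} ky z)) , g (proj₂ (remQuot {kx} ky z))

  grid-combine : ∀ f g i j → grid f g (combine i j) ≡ (f i , g j)
  grid-combine f g i j = cong (λ (i , j) → f i , g j) (Fin.remQuot-combine i j)

  remQuot-injective : ∀ {z z'} → proj₁ (remQuot {kx} ky z) ≡ proj₁ (remQuot {kx} ky z') →
    proj₂ (remQuot {kx} ky z) ≡ proj₂ (remQuot {kx} ky z') → z ≡ z'
  remQuot-injective {z} {z'} e₁ e₂ = begin
    z                                  ≡⟨ Fin.combine-remQuot {kx} ky z ⟨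
    uncurry combine (remQuot {kx} ky z)  ≡⟨ cong₂ combine e₁ e₂ ⟩
    uncurry combine (remQuot {kx} ky z') ≡⟨ Fin.combine-remQuot {kx} ky z' ⟩
    z'                                 ∎
    where open ≡-Reasoning

CpFixedOnBoard : ℕ → Polyomino → ℕ → Set
CpFixedOnBoard n P v =
  (∃ λ S → IsFixedPacking n P S × length S ≡ v) × (∀ S → IsFixedPacking n P S → v ≤ length S)

cpFixed-rect : ∀ a' b' n → suc a' ≤ n → suc b' ≤ n →
  CpFixedOnBoard n (rect (suc a') (suc b')) (Segment.count a' (n ∸ suc a') * Segment.count b' (n ∸ suc b'))
cpFixed-rect a' b' n a≤n b≤n =
  (tabulate (place ∘ slots) , tabulate-fixedPacking slots slots-fit slots-apart slots-cover ,
   length-tabulate (place ∘ slots)) ,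
  λ S packing → fixedPacking-length-≥ packing probes probes-fit probes-isolated
  where
  a b : ℕ
  a = suc a'
  b = suc b'
  module X = Segment a' (n ∸ a)
  module Y = Segment b' (n ∸ b)
  open RectanglePacking a' b' n

  row : Fin (X.count * Y.count) → Fin X.count
  row z = proj₁ (remQuot {X.count} Y.count z)
  col : Fin (X.count * Y.count) → Fin Y.count
  col z = proj₂ (remQuot {X.count} Y.count z)

  probes slots : Fin (X.count * Y.count) → ℕ × ℕ
  probes = grid X.probe Y.probe
  slots = grid X.slot Y.slot

  fits : ∀ {c d} → c ≤ n ∸ a → d ≤ n ∸ b → Fits n a b (c , d)
  fits {c} {d} c≤ d≤ = m≤o∸n⇒m+n≤o c a≤n c≤ , m≤o∸n⇒m+n≤o d b≤n d≤

  probes-fit : ∀ z → Fits n a b (probes z)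
  probes-fit z = fits (X.probe-≤ (row z)) (Y.probe-≤ (col z))

  probes-isolated : ∀ {z z' v} → Overlap a b (probes z) v → Overlap a b (probes z') v → z ≡ z'
  probes-isolated {z} {z'} (x , y) (x' , y') =
    remQuot-injective {X.count} {z = z} {z'} (X.probe-isolated x x') (Y.probe-isolated y y')

  slots-fit : ∀ z → Fits n a b (slots z)
  slots-fit z = fits (X.slot-≤ (row z)) (Y.slot-≤ (col z))

  slots-apart : ∀ {z z'} → Overlap a b (slots z) (slots z') → z ≡ z'
  slots-apart {z} {z'} (x , y) = remQuot-injective {X.count} {z = z} {z'} (X.slot-apart x) (Y.slot-apart y)

  slots-cover : ∀ {u} → Fits n a b u → ∃ λ z → Overlap a b u (slots z)
  slots-cover {c , d} (c+a≤n , d+b≤n)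
    with X.slots-cover (m+n≤o⇒m≤o∸n c c+a≤n) | Y.slots-cover (m+n≤o⇒m≤o∸n d d+b≤n)
  ... | i , c~i | j , d~j =
    combine i j , subst (Overlap a b (c , d)) (sym (grid-combine X.slot Y.slot i j)) (c~i , d~j)

theorem3p6 : (a b : ℕ) → 2 ≤ a → 2 ≤ b →
    CpFixedIs (rect a b)
      (ceilDiv (a * b ∸ a + 1) (2 * a ∸ 1) * ceilDiv (a * b ∸ b + 1) (2 * b ∸ 1))
theorem3p6 a@(suc a') b@(suc b') _ _ =
  subst (λ m → CpFixedIs (rect a b) (Segment.count a' (m ∸ a) * Segment.count b' (m ∸ b))) (length-rect {a} {b})
    (cpFixed-rect a' b' (length (rect a b)) (board-fits (m≤m*n a b)) (board-fits (m≤n*m b a)))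
  where
  board-fits : ∀ {w} → w ≤ a * b → w ≤ length (rect a b)
  board-fits {w} = subst (_≤_ w) (sym (length-rect {a} {b}))
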